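{- Let $k$ be a positive integer and let $\mathcal{H}$ be a hypergraph all of whose hyperedges have size between $2$ and $4$, containing no Berge copy of the path $P_k$ with $k$ edges. Then $\chi_s(\mathcal{H})\le k+9$. In particular, $\mathrm{schex}_4(n,\mathcal{B}(P_k))\le k+9$ for every $n$.
   Context: A hypergraph contains a Berge copy of a graph $T$ if there are distinct hyperedges $f(e)$, $e\in E(T)$, and an injective map $\varphi:V(T)\to V(\mathcal{H})$ with $\{\varphi(x),\varphi(y)\}\subseteq f(xy)$ for every $xy\in E(T)$; $\mathcal{B}(T)$ denotes the family of hypergraphs that are Berge copies of $T$. $\chi_s$ (strong chromatic number) is the minimum number of colors in a vertex coloring in which every hyperedge is rainbow. $\mathrm{schex}_4(n,\mathcal{B}(P_k))$ is the supremum of $\chi_s$ over $4$-uniform hypergraphs on $n$ vertices containing no Berge copy of $P_k$. -}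

module Defs where

open import Data.Nat using (ℕ; suc; _≤_)
open import Data.Fin using (Fin; zero; suc; inject₁)
open import Data.Fin.Subset using (Subset; _∈_; ∣_∣)
open import Data.Product using (Σ; _×_)
open import Function.Definitions using (Injective)
open import Relation.Binary.PropositionalEquality using (_≡_)
open import Relation.Nullary using (¬_)

-- A finite hypergraph on vertex set Fin n with m hyperedges.
-- Hyperedges are subsets of the vertex set; the indexing is required to be
-- injective (see IsSimple), so the hyperedges form a set.
record Hypergraph (n : ℕ) : Set where
  field
    m    : ℕ
    edge : Fin m → Subset n

open Hypergraph public

IsSimple : ∀ {n} → Hypergraph n → Set
IsSimple H = Injective _≡_ _≡_ (edge H)

SizesBetween2and4 : ∀ {n} → Hypergraph n → Set
SizesBetween2and4 H = ∀ i → 2 ≤ ∣ edge H i ∣ × ∣ edge H i ∣ ≤ 4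

-- Berge copy of the path P_k (vertices 0,1,…,k; edges {j, j+1} for j < k):
-- an injective vertex map φ and distinct hyperedges f(j) with
-- φ(j), φ(j+1) ∈ f(j).
BergePath : ∀ {n} → ℕ → Hypergraph n → Set
BergePath {n} k H =
  Σ (Fin (suc k) → Fin n) λ φ →
  Σ (Fin k → Fin (m H)) λ f →
    Injective _≡_ _≡_ φ × Injective _≡_ _≡_ f ×
    (∀ (j : Fin k) → φ (inject₁ j) ∈ edge H (f j) × φ (suc j) ∈ edge H (f j))

IsStrongColouring : ∀ {n} (H : Hypergraph n) (c : ℕ) → (Fin n → Fin c) → Set
IsStrongColouring {n} H c col =
  ∀ (i : Fin (m H)) (u v : Fin n) → u ∈ edge H i → v ∈ edge H i →
    ¬ (u ≡ v) → ¬ (col u ≡ col v)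

StrongChromaticAtMost : ∀ {n} → Hypergraph n → ℕ → Set
StrongChromaticAtMost {n} H c = Σ (Fin n → Fin c) (IsStrongColouring H c)

-- Greedy colouring gives k + 9 colours once every nonempty vertex set W contains a
-- vertex with at most k + 8 neighbours in W; so suppose all vertices of W have at
-- least k + 9, and take a Berge path in W of length t < k that cannot be extended,
-- ending at x. Every neighbour of x lies on the path or in a path edge through x.
-- The last path edge contains at most two vertices off the path, and any other
-- edge, of size at most four, at most one; so at least 8 path edges through x
-- reach off the path without linking x. Such an edge has a unique path vertex it
-- does not link, its owner. A Pósa rotation along an edge owned by the end keeps
-- the vertex and edge sets and moves the end along the path. Closing the set of
-- ends under these rotations, every end owns at least 7 edges, each of them is
-- linked by the original path to some end, and every vertex is linked by at most
-- two path edges: 7 · #ends ≤ 2 · #ends, a contradiction.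

module Submission where

open import Defs
open import Data.Bool using (if_then_else_)
open import Data.Empty using (⊥; ⊥-elim)
open import Data.Fin using (Fin; zero; suc; toℕ)
open import Data.Fin.Properties using (_≟_; any?; toℕ-injective; toℕ-inject₁; toℕ<n)
import Data.Fin.Properties as Fin
open import Data.Fin.Subset using (Subset; inside; outside; _∈_; _-_; ∣_∣; ⊤)
open import Data.Fin.Subset.Properties using (_∈?_; nonempty?; x∈p⇒∣p-x∣<∣p∣; x∈p∧x∉q⇒x∈p─q; x≢y⇒x∉⁅y⁆; ∈⊤)
open import Data.List using (List; []; _∷_; length)
open import Data.List.Membership.Propositional using (find) renaming (_∈_ to _∈ₗ_; _∉_ to _∉ₗ_)
open import Data.List.Relation.Unary.All using (All; []; _∷_)
import Data.List.Relation.Unary.All as All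
open import Data.List.Relation.Unary.All.Properties using (All¬⇒¬Any; ¬Any⇒All¬)
open import Data.List.Relation.Unary.AllPairs using ([]; _∷_)
open import Data.List.Relation.Unary.Any using (Any; here; there)
import Data.List.Relation.Unary.Any as Any
open import Data.List.Relation.Unary.Unique.Propositional using (Unique)
open import Data.Nat using (ℕ; zero; suc; _+_; _*_; _∸_; _≤_; _<_; _≤?_; _<?_; z≤n; s≤s; s≤s⁻¹) renaming (_≟_ to _≟ℕ_)
open import Data.Nat.Induction using (<-wellFounded)
open import Data.Nat.Properties hiding (_≟_)
open import Algebra.Properties.Semiring.Sum +-*-semiring using (sum; ∑-distrib-+; *-distribˡ-sum)
open import Data.Product using (Σ; ∃; _×_; _,_; proj₁; proj₂)
open import Data.Sum using (_⊎_; inj₁; inj₂; swap)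
import Data.Sum as Sum
open import Data.Unit using (tt)
open import Data.Vec using (_∷_; [])
open import Data.Vec.Functional using (Vector; updateAt)
open import Data.Vec.Functional.Properties using (updateAt-updates; updateAt-minimal)
open import Function using (_∘_; id)
open import Induction.WellFounded using (Acc; acc)
open import Level using (0ℓ)
open import Relation.Binary.Definitions using (DecidableEquality; tri<; tri≈; tri>)
open import Relation.Binary.PropositionalEquality using (_≡_; _≢_; refl; sym; trans; cong; subst; subst₂; module ≡-Reasoning)
open import Relation.Nullary using (¬_; ¬?; Dec; yes; no; does; contradiction)
open import Relation.Nullary.Decidable using (_×-dec_; _⊎-dec_)
open import Relation.Unary using (Pred; Decidable; ∅; U; _⊆_; _∪_; Empty; Universal; Satisfiable)
open import Relation.Unary.Properties using (_∩?_; ∁?)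

variable
  n : ℕ

-- Counting decidable subsets of Fin n

indicator : {A : Set} → Dec A → ℕ
indicator d = if does d then 1 else 0

count : {P : Pred (Fin n) 0ℓ} → Decidable P → ℕ
count P? = sum (λ x → indicator (P? x))

sum-mono-≤ : {f g : Vector ℕ n} → (∀ x → f x ≤ g x) → sum f ≤ sum g
sum-mono-≤ {zero}  f≤g = z≤n
sum-mono-≤ {suc n} f≤g = +-mono-≤ (f≤g zero) (sum-mono-≤ (f≤g ∘ suc))

indicator-mono : {A B : Set} (a : Dec A) (b : Dec B) → (A → B) → indicator a ≤ indicator b
indicator-mono (yes a) (yes _) _   = ≤-refl
indicator-mono (yes a) (no ¬b) A→B = contradiction (A→B a) ¬b
indicator-mono (no _)  _       _   = z≤n

indicator-∪ : {A B C : Set} (a : Dec A) (b : Dec B) (c : Dec C) →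
              (C → A ⊎ B) → indicator c ≤ indicator a + indicator b
indicator-∪ _       _       (no _)  _ = z≤n
indicator-∪ (yes _) _       (yes _) _ = s≤s z≤n
indicator-∪ (no _)  (yes _) (yes _) _ = s≤s z≤n
indicator-∪ (no ¬a) (no ¬b) (yes c) C→A⊎B with C→A⊎B c
... | inj₁ a = contradiction a ¬a
... | inj₂ b = contradiction b ¬b

indicator-disjoint : {A B C : Set} (a : Dec A) (b : Dec B) (c : Dec C) →
                     (A → C) → (B → C) → (A → ¬ B) → indicator a + indicator b ≤ indicator c
indicator-disjoint (yes a) (yes b) _       _   _   A→¬B = contradiction b (A→¬B a)
indicator-disjoint (yes _) (no _)  (yes _) _   _   _    = ≤-refl
indicator-disjoint (yes a) (no _)  (no ¬c) A→C _   _    = contradiction (A→C a) ¬c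
indicator-disjoint (no _)  (yes _) (yes _) _   _   _    = ≤-refl
indicator-disjoint (no _)  (yes b) (no ¬c) _   B→C _    = contradiction (B→C b) ¬c
indicator-disjoint (no _)  (no _)  _       _   _   _    = z≤n

count-mono : {P Q : Pred (Fin n) 0ℓ} (P? : Decidable P) (Q? : Decidable Q) → P ⊆ Q → count P? ≤ count Q?
count-mono P? Q? P⊆Q = sum-mono-≤ (λ x → indicator-mono (P? x) (Q? x) P⊆Q)

module _ {P Q R : Pred (Fin n) 0ℓ} (P? : Decidable P) (Q? : Decidable Q) (R? : Decidable R) where

  count-∪ : R ⊆ P ∪ Q → count R? ≤ count P? + count Q?
  count-∪ R⊆P∪Q = begin
    count R?                                          ≤⟨ sum-mono-≤ (λ x → indicator-∪ (P? x) (Q? x) (R? x) R⊆P∪Q) ⟩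
    sum (λ x → indicator (P? x) + indicator (Q? x))   ≡⟨ ∑-distrib-+ (indicator ∘ P?) (indicator ∘ Q?) ⟩
    count P? + count Q?                               ∎
    where open ≤-Reasoning

  count-disjoint-∪ : P ⊆ R → Q ⊆ R → (∀ {x} → P x → ¬ Q x) → count P? + count Q? ≤ count R?
  count-disjoint-∪ P⊆R Q⊆R disjoint = begin
    count P? + count Q?                               ≡⟨ ∑-distrib-+ (indicator ∘ P?) (indicator ∘ Q?) ⟨
    sum (λ x → indicator (P? x) + indicator (Q? x))   ≤⟨ sum-mono-≤ (λ x → indicator-disjoint (P? x) (Q? x) (R? x) P⊆R Q⊆R disjoint) ⟩
    count R?                                          ∎
    where open ≤-Reasoning

count-∅ : {P : Pred (Fin n) 0ℓ} (P? : Decidable P) → Empty P → count P? ≡ 0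
count-∅ {zero}  P? _ = refl
count-∅ {suc n} P? empty with P? zero
... | yes p = contradiction p (empty zero)
... | no _  = count-∅ (P? ∘ suc) (empty ∘ suc)

count-U : {P : Pred (Fin n) 0ℓ} (P? : Decidable P) → Universal P → count P? ≡ n
count-U {zero}  P? _ = refl
count-U {suc n} P? universal with P? zero
... | yes _ = cong suc (count-U (P? ∘ suc) (universal ∘ suc))
... | no ¬p = contradiction (universal zero) ¬p

∅? : Decidable {A = Fin n} ∅
∅? _ = no (λ ())

U? : Decidable {A = Fin n} U
U? _ = yes tt

count≤1 : {P : Pred (Fin n) 0ℓ} (P? : Decidable P) → (∀ {x y} → P x → P y → x ≡ y) → count P? ≤ 1
count≤1 {zero}  P? _ = z≤n
count≤1 {suc n} P? unique with P? zero
... | yes p = ≤-reflexive (cong suc (count-∅ (P? ∘ suc) (λ x q → Fin.0≢1+n (unique p q))))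
... | no _  = count≤1 (P? ∘ suc) (λ p q → Fin.suc-injective (unique p q))

1≤count : {P : Pred (Fin n) 0ℓ} (P? : Decidable P) {x : Fin n} → P x → 1 ≤ count P?
1≤count P? {zero} p with P? zero
... | yes _ = s≤s z≤n
... | no ¬p = contradiction p ¬p
1≤count P? {suc x} p = ≤-trans (1≤count (P? ∘ suc) p) (m≤n+m _ (indicator (P? zero)))

count<⇒∃ : {P Q : Pred (Fin n) 0ℓ} (P? : Decidable P) (Q? : Decidable Q) →
           count P? < count Q? → ∃ λ x → Q x × ¬ P x
count<⇒∃ {P = P} {Q = Q} P? Q? P<Q with any? (Q? ∩? ∁? P?)
... | yes witness = witness
... | no none     = contradiction (count-mono Q? P? Q⊆P) (<⇒≱ P<Q)
  where
  Q⊆P : Q ⊆ P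
  Q⊆P {x} q with P? x
  ... | yes p = p
  ... | no ¬p = contradiction (x , q , ¬p) none

0<count⇒satisfiable : {P : Pred (Fin n) 0ℓ} (P? : Decidable P) → 0 < count P? → Satisfiable P
0<count⇒satisfiable {n} P? 0<count with count<⇒∃ ∅? P? (subst (_< count P?) (sym (count-∅ (∅? {n}) (λ _ ()))) 0<count)
... | x , p , _ = x , p

count<n⇒∃∁ : {P : Pred (Fin n) 0ℓ} (P? : Decidable P) → count P? < n → ∃ λ x → ¬ P x
count<n⇒∃∁ P? count<n with count<⇒∃ P? U? (subst (count P? <_) (sym (count-U U? _)) count<n)
... | x , _ , ¬p = x , ¬p

count-remove : {P P′ : Pred (Fin n) 0ℓ} (P? : Decidable P) (P′? : Decidable P′) {a : Fin n} →
               P′ ⊆ P → P a → (∀ {x} → P′ x → x ≢ a) → suc (count P′?) ≤ count P?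
count-remove P? P′? {a} P′⊆P pa a∉P′ = begin
  suc (count P′?)           ≤⟨ +-monoˡ-≤ (count P′?) (1≤count (_≟ a) refl) ⟩
  count (_≟ a) + count P′?  ≤⟨ count-disjoint-∪ (_≟ a) P′? P? (λ { refl → pa }) P′⊆P (λ { refl p′ → a∉P′ p′ refl }) ⟩
  count P?                  ∎
  where open ≤-Reasoning

count-∃≤∑ : {m : ℕ} {R : Fin m → Pred (Fin n) 0ℓ} (R? : ∀ g → Decidable (R g)) →
            (∃R? : Decidable (λ u → ∃ λ g → R g u)) → count ∃R? ≤ sum (λ g → count (R? g))
count-∃≤∑ {m = zero}  R? ∃R? = ≤-reflexive (count-∅ ∃R? (λ _ ()))
count-∃≤∑ {m = suc m} {R} R? ∃R? = begin
  count ∃R?                                   ≤⟨ count-∪ (R? zero) ∃R′? ∃R? split ⟩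
  count (R? zero) + count ∃R′?                ≤⟨ +-monoʳ-≤ (count (R? zero)) (count-∃≤∑ (R? ∘ suc) ∃R′?) ⟩
  count (R? zero) + sum (λ g → count (R? (suc g))) ∎
  where
  open ≤-Reasoning
  ∃R′? : Decidable (λ u → ∃ λ g → R (suc g) u)
  ∃R′? u = any? (λ g → R? (suc g) u)
  split : (λ u → ∃ λ g → R g u) ⊆ R zero ∪ (λ u → ∃ λ g → R (suc g) u)
  split (zero  , r) = inj₁ r
  split (suc g , r) = inj₂ (g , r)

count-image≤ : {m : ℕ} {P : Pred (Fin n) 0ℓ} (P? : Decidable P) (h : Fin n → Fin m) →
               count (λ y → any? (λ x → P? x ×-dec h x ≟ y)) ≤ count P?
count-image≤ {P = P} P? h = ≤-trans (count-∃≤∑ (λ x y → P? x ×-dec h x ≟ y) (λ y → any? (λ x → P? x ×-dec h x ≟ y)))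
                            (sum-mono-≤ (λ x → per-point x (P? x)))
  where
  per-point : ∀ x (p? : Dec (P x)) → count (λ y → p? ×-dec h x ≟ y) ≤ indicator p?
  per-point x (yes p) = count≤1 (λ y → yes p ×-dec h x ≟ y) (λ { (_ , refl) (_ , refl) → refl })
  per-point x (no ¬p) = ≤-reflexive (count-∅ (λ y → no ¬p ×-dec h x ≟ y) (λ _ → ¬p ∘ proj₁))

count-∈≡∣p∣ : (p : Subset n) → count (_∈? p) ≡ ∣ p ∣
count-∈≡∣p∣ []            = refl
count-∈≡∣p∣ (inside  ∷ p) = cong suc (count-∈≡∣p∣ p)
count-∈≡∣p∣ (outside ∷ p) = count-∈≡∣p∣ p

unique-length+count≤count : {P R : Pred (Fin n) 0ℓ} (P? : Decidable P) (R? : Decidable R) {xs : List (Fin n)} →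
  Unique xs → All P xs → (∀ {x} → R x → P x × All (x ≢_) xs) → length xs + count R? ≤ count P?
unique-length+count≤count P? R? {[]}     _ _ R⊆P = count-mono R? P? (proj₁ ∘ R⊆P)
unique-length+count≤count {P = P} {R} P? R? {a ∷ xs} (a∉xs ∷ unique) (pa ∷ pxs) R⊆P =
  ≤-trans (s≤s (unique-length+count≤count P′? R? unique pxs′ R⊆P′))
          (count-remove P? P′? proj₁ pa proj₂)
  where
  P′? : Decidable (λ x → P x × x ≢ a)
  P′? = P? ∩? ∁? (_≟ a)
  pxs′ : All (λ x → P x × x ≢ a) xs
  pxs′ = All.zipWith (λ (p , a≢x) → p , a≢x ∘ sym) (pxs , a∉xs)
  R⊆P′ : ∀ {x} → R x → (P x × x ≢ a) × All (x ≢_) xs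
  R⊆P′ r with R⊆P r
  ... | p , (x≢a ∷ x∉xs) = (p , x≢a) , x∉xs

unique-length≤count : {P : Pred (Fin n) 0ℓ} (P? : Decidable P) {xs : List (Fin n)} →
                      Unique xs → All P xs → length xs ≤ count P?
unique-length≤count P? {xs} unique pxs =
  ≤-trans (m≤m+n (length xs) _) (unique-length+count≤count P? ∅? unique pxs (λ ()))

module _ {m : ℕ} {R : Fin m → Pred (Fin n) 0ℓ} (R? : ∀ x → Decidable (R x)) where

  any-in? : (xs : List (Fin m)) → Decidable (λ g → Any (λ x → R x g) xs)
  any-in? xs g = Any.any? (λ x → R? x g) xs

  count-any≤ : {c : ℕ} → (∀ x → count (R? x) ≤ c) → (xs : List (Fin m)) → count (any-in? xs) ≤ length xs * c
  count-any≤ bound []       = ≤-reflexive (count-∅ (any-in? []) (λ _ ()))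
  count-any≤ {c} bound (x ∷ xs) = begin
    count (any-in? (x ∷ xs))           ≤⟨ count-∪ (R? x) (any-in? xs) (any-in? (x ∷ xs)) split ⟩
    count (R? x) + count (any-in? xs)  ≤⟨ +-mono-≤ (bound x) (count-any≤ bound xs) ⟩
    c + length xs * c                  ∎
    where
    open ≤-Reasoning
    split : (λ g → Any (λ x → R x g) (x ∷ xs)) ⊆ R x ∪ (λ g → Any (λ x → R x g) xs)
    split (here r)  = inj₁ r
    split (there a) = inj₂ a

  count-any≥ : {c : ℕ} → (∀ {x y g} → R x g → R y g → x ≡ y) →
               {xs : List (Fin m)} → Unique xs → All (λ x → c ≤ count (R? x)) xs → length xs * c ≤ count (any-in? xs)
  count-any≥ unique-owner {[]}     _                []              = z≤n
  count-any≥ {c} unique-owner {x ∷ xs} (x∉xs ∷ unique) (bound ∷ bounds) = begin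
    c + length xs * c                  ≤⟨ +-mono-≤ bound (count-any≥ unique-owner unique bounds) ⟩
    count (R? x) + count (any-in? xs)  ≤⟨ count-disjoint-∪ (R? x) (any-in? xs) (any-in? (x ∷ xs)) here there disjoint ⟩
    count (any-in? (x ∷ xs))           ∎
    where
    open ≤-Reasoning
    disjoint : ∀ {g} → R x g → ¬ Any (λ y → R y g) xs
    disjoint r a with find a
    ... | y , y∈xs , r′ = contradiction (subst (_∈ₗ xs) (unique-owner r′ r) y∈xs) (All¬⇒¬Any x∉xs)

-- Maps on initial segments of ℕ

InjectiveBelow : {A : Set} → ℕ → (ℕ → A) → Set
InjectiveBelow b h = ∀ {p q} → p < b → q < b → h p ≡ h q → p ≡ q

ImageBelow : {A : Set} → ℕ → (ℕ → A) → A → Set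
ImageBelow b h a = ∃ λ p → p < b × h p ≡ a

imageBelow? : {A : Set} → DecidableEquality A → (b : ℕ) (h : ℕ → A) → Decidable (ImageBelow b h)
imageBelow? _≟_ b h a = anyUpTo? (λ p → h p ≟ a) b

InvolutionBelow : ℕ → (ℕ → ℕ) → Set
InvolutionBelow b r = ∀ {p} → p < b → r p < b × r (r p) ≡ p

module _ {A : Set} {b : ℕ} {r : ℕ → ℕ} (r-inv : InvolutionBelow b r) where

  ∘-involution-injective : {h : ℕ → A} → InjectiveBelow b h → InjectiveBelow b (h ∘ r)
  ∘-involution-injective h-inj {p} {q} p<b q<b hrp≡hrq = begin
    p          ≡⟨ proj₂ (r-inv p<b) ⟨
    r (r p)    ≡⟨ cong r (h-inj (proj₁ (r-inv p<b)) (proj₁ (r-inv q<b)) hrp≡hrq) ⟩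
    r (r q)    ≡⟨ proj₂ (r-inv q<b) ⟩
    q          ∎
    where open ≡-Reasoning

  ∘-involution-image⁺ : {h : ℕ → A} {a : A} → ImageBelow b h a → ImageBelow b (h ∘ r) a
  ∘-involution-image⁺ {h} (p , p<b , hp≡a) = r p , proj₁ (r-inv p<b) , trans (cong h (proj₂ (r-inv p<b))) hp≡a

  ∘-involution-image⁻ : {h : ℕ → A} {a : A} → ImageBelow b (h ∘ r) a → ImageBelow b h a
  ∘-involution-image⁻ (p , p<b , hrp≡a) = r p , proj₁ (r-inv p<b) , hrp≡a

count-imageBelow≤ : (b : ℕ) (h : ℕ → Fin n) → count (imageBelow? _≟_ b h) ≤ b
count-imageBelow≤ zero    h = ≤-reflexive (count-∅ (imageBelow? _≟_ 0 h) (λ _ ()))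
count-imageBelow≤ (suc b) h = begin
  count (imageBelow? _≟_ (suc b) h)               ≤⟨ count-∪ (h b ≟_) (imageBelow? _≟_ b h) (imageBelow? _≟_ (suc b) h) split ⟩
  count (h b ≟_) + count (imageBelow? _≟_ b h)    ≤⟨ +-mono-≤ (count≤1 (h b ≟_) (λ { refl refl → refl })) (count-imageBelow≤ b h) ⟩
  suc b                                           ∎
  where
  open ≤-Reasoning
  split : ImageBelow (suc b) h ⊆ (h b ≡_) ∪ ImageBelow b h
  split (p , p<1+b , hp≡a) with m<1+n⇒m<n∨m≡n p<1+b
  ... | inj₁ p<b  = inj₂ (p , p<b , hp≡a)
  ... | inj₂ refl = inj₁ hp≡a

snoc : {A : Set} → (ℕ → A) → ℕ → A → ℕ → A
snoc h b a p with p <? b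
... | yes _ = h p
... | no _  = a

module _ {A : Set} {h : ℕ → A} {b : ℕ} {a : A} where

  snoc-< : ∀ {p} → p < b → snoc h b a p ≡ h p
  snoc-< {p} p<b with p <? b
  ... | yes _   = refl
  ... | no p≮b  = contradiction p<b p≮b

  snoc-≥ : ∀ {p} → b ≤ p → snoc h b a p ≡ a
  snoc-≥ {p} b≤p with p <? b
  ... | yes p<b = contradiction b≤p (<⇒≱ p<b)
  ... | no _    = refl

  snoc-injective : InjectiveBelow b h → (∀ {p} → p < b → h p ≢ a) → InjectiveBelow (suc b) (snoc h b a)
  snoc-injective h-inj a-new {p} {q} p≤b q≤b eq with m<1+n⇒m<n∨m≡n p≤b | m<1+n⇒m<n∨m≡n q≤b
  ... | inj₁ p<b | inj₁ q<b = h-inj p<b q<b (trans (sym (snoc-< p<b)) (trans eq (snoc-< q<b)))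
  ... | inj₁ p<b | inj₂ refl = contradiction (trans (sym (snoc-< p<b)) (trans eq (snoc-≥ ≤-refl))) (a-new p<b)
  ... | inj₂ refl | inj₁ q<b = contradiction (trans (sym (snoc-< q<b)) (trans (sym eq) (snoc-≥ ≤-refl))) (a-new q<b)
  ... | inj₂ refl | inj₂ refl = refl

-- reflect i s fixes 0, …, i and reverses the segment i + 1, …, s.
reflect : ℕ → ℕ → ℕ → ℕ
reflect i s p with p ≤? i
... | yes _ = p
... | no _  = suc (i + s) ∸ p

module _ {i s : ℕ} where

  reflect-≤ : ∀ {p} → p ≤ i → reflect i s p ≡ p
  reflect-≤ {p} p≤i with p ≤? i
  ... | yes _   = refl
  ... | no p≰i  = contradiction p≤i p≰i

  reflect-> : ∀ {p} → i < p → reflect i s p ≡ suc (i + s) ∸ p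
  reflect-> {p} i<p with p ≤? i
  ... | yes p≤i = contradiction p≤i (<⇒≱ i<p)
  ... | no _    = refl

  i<mirror : ∀ {p} → p ≤ s → i < suc (i + s) ∸ p
  i<mirror {p} p≤s = subst (_≤ suc (i + s) ∸ p) (m+n∸n≡m (suc i) s) (∸-monoʳ-≤ (suc (i + s)) p≤s)

  mirror≤s : ∀ {p} → i < p → suc (i + s) ∸ p ≤ s
  mirror≤s {p} i<p = subst (suc (i + s) ∸ p ≤_) (m+n∸m≡n i s) (∸-monoʳ-≤ (suc (i + s)) i<p)

  reflect-involution : InvolutionBelow (suc s) (reflect i s)
  reflect-involution {p} p<1+s with p ≤? i
  ... | yes p≤i = p<1+s , reflect-≤ p≤i
  ... | no p≰i  = s≤s (mirror≤s (≰⇒> p≰i)) , (begin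
    reflect i s (suc (i + s) ∸ p)    ≡⟨ reflect-> (i<mirror (s≤s⁻¹ p<1+s)) ⟩
    suc (i + s) ∸ (suc (i + s) ∸ p)  ≡⟨ m∸[m∸n]≡n (m≤n⇒m≤1+n (≤-trans (s≤s⁻¹ p<1+s) (m≤n+m s i))) ⟩
    p                                ∎)
    where open ≡-Reasoning

module _ {i s : ℕ} where

  reflect-suc-i : reflect i (suc s) (suc i) ≡ suc s
  reflect-suc-i = trans (reflect-> {i} {suc s} ≤-refl) (m+n∸m≡n i (suc s))

  reflect-step : ∀ {j} → j ≤ s → j ≢ i →
    (reflect i (suc s) j ≡ reflect i s j × reflect i (suc s) (suc j) ≡ suc (reflect i s j)) ⊎
    (reflect i (suc s) j ≡ suc (reflect i s j) × reflect i (suc s) (suc j) ≡ reflect i s j)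
  reflect-step {j} j≤s j≢i with <-cmp j i
  ... | tri< j<i _ _ = inj₁ (trans (reflect-≤ (<⇒≤ j<i)) (sym (reflect-≤ (<⇒≤ j<i))) ,
                             trans (reflect-≤ j<i) (cong suc (sym (reflect-≤ (<⇒≤ j<i)))))
  ... | tri≈ _ j≡i _ = contradiction j≡i j≢i
  ... | tri> _ _ i<j = inj₂ (trans (reflect-> i<j) (trans shift (cong suc (sym (reflect-> i<j)))) ,
                             trans (reflect-> (m<n⇒m<1+n i<j)) (trans (cong (_∸ j) (+-suc i s)) (sym (reflect-> i<j))))
    where
    shift : suc (i + suc s) ∸ j ≡ suc (suc (i + s) ∸ j)
    shift = trans (cong (λ x → suc x ∸ j) (+-suc i s)) (+-∸-assoc 1 (m≤n⇒m≤1+n (≤-trans j≤s (m≤n+m s i))))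

-- Berge paths inside a vertex set

module OnVertexSet {n : ℕ} (H : Hypergraph n) (W : Subset n) where

  Adjacent : Fin n → Fin n → Set
  Adjacent x u = ∃ λ g → x ∈ edge H g × u ∈ edge H g

  Neighbour : Fin n → Pred (Fin n) 0ℓ
  Neighbour x u = u ∈ W × u ≢ x × Adjacent x u

  neighbour? : (x : Fin n) → Decidable (Neighbour x)
  neighbour? x u = u ∈? W ×-dec ¬? (u ≟ x) ×-dec any? (λ g → x ∈? edge H g ×-dec u ∈? edge H g)

  degree : Fin n → ℕ
  degree x = count (neighbour? x)

  -- Only φ p for p ≤ t and f j for j < t belong to the path; the other values are junk.
  record Path (t : ℕ) : Set where
    field
      φ : ℕ → Fin n
      f : ℕ → Fin (m H)
      φ-injective : InjectiveBelow (suc t) φ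
      f-injective : InjectiveBelow t f
      φ∈f    : ∀ {j} → j < t → φ j ∈ edge H (f j)
      φsuc∈f : ∀ {j} → j < t → φ (suc j) ∈ edge H (f j)
      alive  : ∀ {p} → p < suc t → φ p ∈ W

  open Path public

  variable
    t : ℕ

  end : Path t → Fin n
  end {t} Q = φ Q t

  OnPath : Path t → Pred (Fin n) 0ℓ
  OnPath {t} Q = ImageBelow (suc t) (φ Q)

  EdgeOf : Path t → Pred (Fin (m H)) 0ℓ
  EdgeOf {t} Q = ImageBelow t (f Q)

  Ends : Path t → ℕ → Pred (Fin n) 0ℓ
  Ends Q j u = φ Q j ≡ u ⊎ φ Q (suc j) ≡ u

  Links : Path t → Fin (m H) → Pred (Fin n) 0ℓ
  Links {t} Q g u = ∃ λ j → j < t × f Q j ≡ g × Ends Q j u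

  onPath? : (Q : Path t) → Decidable (OnPath Q)
  onPath? {t} Q = imageBelow? _≟_ (suc t) (φ Q)

  edgeOf? : (Q : Path t) → Decidable (EdgeOf Q)
  edgeOf? {t} Q = imageBelow? _≟_ t (f Q)

  links? : (Q : Path t) (g : Fin (m H)) → Decidable (Links Q g)
  links? {t} Q g u = anyUpTo? (λ j → f Q j ≟ g ×-dec (φ Q j ≟ u ⊎-dec φ Q (suc j) ≟ u)) t

  φ-onPath : (Q : Path t) {p : ℕ} → p < suc t → OnPath Q (φ Q p)
  φ-onPath Q p<1+t = _ , p<1+t , refl

  end-onPath : (Q : Path t) → OnPath Q (end Q)
  end-onPath Q = φ-onPath Q (n<1+n _)

  singleton : {u : Fin n} → Fin (m H) → u ∈ W → Path 0
  singleton {u} g u∈W = record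
    { φ = λ _ → u
    ; f = λ _ → g
    ; φ-injective = λ { (s≤s z≤n) (s≤s z≤n) _ → refl }
    ; f-injective = λ ()
    ; φ∈f = λ ()
    ; φsuc∈f = λ ()
    ; alive = λ _ → u∈W
    }

  toBergePath : Path t → BergePath t H
  toBergePath Q =
    φ Q ∘ toℕ , f Q ∘ toℕ ,
    (λ eq → toℕ-injective (φ-injective Q (toℕ<n _) (toℕ<n _) eq)) ,
    (λ eq → toℕ-injective (f-injective Q (toℕ<n _) (toℕ<n _) eq)) ,
    λ j → subst (λ p → φ Q p ∈ edge H (f Q (toℕ j))) (sym (toℕ-inject₁ j)) (φ∈f Q (toℕ<n j)) , φsuc∈f Q (toℕ<n j)

  extend : (Q : Path t) {g : Fin (m H)} {u : Fin n} → ¬ EdgeOf Q g → end Q ∈ edge H g →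
           u ∈ edge H g → u ∈ W → ¬ OnPath Q u → Path (suc t)
  extend {t} Q {g} {u} g∉Q end∈g u∈g u∈W u∉Q = record
    { φ = φ′
    ; f = f′
    ; φ-injective = snoc-injective (φ-injective Q) (λ p<1+t φp≡u → u∉Q (_ , p<1+t , φp≡u))
    ; f-injective = snoc-injective (f-injective Q) (λ j<t fj≡g → g∉Q (_ , j<t , fj≡g))
    ; φ∈f = left∈
    ; φsuc∈f = right∈
    ; alive = alive′
    }
    where
    φ′ : ℕ → Fin n
    φ′ = snoc (φ Q) (suc t) u
    f′ : ℕ → Fin (m H)
    f′ = snoc (f Q) t g
    φ′-end : φ′ (suc t) ≡ u
    φ′-end = snoc-≥ {h = φ Q} {b = suc t} ≤-refl
    f′-end : f′ t ≡ g
    f′-end = snoc-≥ {h = f Q} {b = t} ≤-refl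
    left∈ : ∀ {j} → j < suc t → φ′ j ∈ edge H (f′ j)
    left∈ j<1+t with m<1+n⇒m<n∨m≡n j<1+t
    ... | inj₁ j<t  = subst₂ (λ v e → v ∈ edge H e) (sym (snoc-< j<1+t)) (sym (snoc-< j<t)) (φ∈f Q j<t)
    ... | inj₂ refl = subst₂ (λ v e → v ∈ edge H e) (sym (snoc-< {h = φ Q} j<1+t)) (sym f′-end) end∈g
    right∈ : ∀ {j} → j < suc t → φ′ (suc j) ∈ edge H (f′ j)
    right∈ j<1+t with m<1+n⇒m<n∨m≡n j<1+t
    ... | inj₁ j<t  = subst₂ (λ v e → v ∈ edge H e) (sym (snoc-< (s≤s j<t))) (sym (snoc-< j<t)) (φsuc∈f Q j<t)
    ... | inj₂ refl = subst₂ (λ v e → v ∈ edge H e) (sym φ′-end) (sym f′-end) u∈g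
    alive′ : ∀ {p} → p < suc (suc t) → φ′ p ∈ W
    alive′ p<2+t with m<1+n⇒m<n∨m≡n p<2+t
    ... | inj₁ p<1+t = subst (_∈ W) (sym (snoc-< p<1+t)) (alive Q p<1+t)
    ... | inj₂ refl  = subst (_∈ W) (sym φ′-end) u∈W

  ends⊆edge : (Q : Path t) {j : ℕ} {u : Fin n} → j < t → Ends Q j u → u ∈ edge H (f Q j)
  ends⊆edge Q j<t (inj₁ refl) = φ∈f Q j<t
  ends⊆edge Q j<t (inj₂ refl) = φsuc∈f Q j<t

  ends-distinct : (Q : Path t) {j : ℕ} → j < t → φ Q j ≢ φ Q (suc j)
  ends-distinct Q j<t eq = 1+n≢n (sym (φ-injective Q (m<n⇒m<1+n j<t) (s≤s j<t) eq))

  module _ (Q : Path t) {g : Fin (m H)} {j : ℕ} (j<t : j < t) (fj≡g : f Q j ≡ g) where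

    ends∈edge : φ Q j ∈ edge H g × φ Q (suc j) ∈ edge H g
    ends∈edge = subst (λ e → φ Q j ∈ edge H e) fj≡g (φ∈f Q j<t) , subst (λ e → φ Q (suc j) ∈ edge H e) fj≡g (φsuc∈f Q j<t)

    unlinked⇒≢ends : ∀ {z} → ¬ Links Q g z → φ Q j ≢ z × φ Q (suc j) ≢ z
    unlinked⇒≢ends unlinked = (λ eq → unlinked (j , j<t , fj≡g , inj₁ eq)) , (λ eq → unlinked (j , j<t , fj≡g , inj₂ eq))

  last-edge : (Q : Path t) {g : Fin (m H)} → Links Q g (end Q) → ∃ λ j → suc j ≡ t × f Q j ≡ g
  last-edge Q (j , j<t , _ , inj₁ φj≡end) = contradiction (φ-injective Q (m<n⇒m<1+n j<t) (n<1+n _) φj≡end) (<⇒≢ j<t)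
  last-edge Q (j , j<t , fj≡g , inj₂ eq)  = j , φ-injective Q (s≤s j<t) (n<1+n _) eq , fj≡g

  count-links-end≤1 : (Q : Path t) → count (λ g → links? Q g (end Q)) ≤ 1
  count-links-end≤1 Q = count≤1 (λ g → links? Q g (end Q)) same
    where
    same : ∀ {g g′} → Links Q g (end Q) → Links Q g′ (end Q) → g ≡ g′
    same linked linked′ with last-edge Q linked | last-edge Q linked′
    ... | j , 1+j≡t , fj≡g | j′ , 1+j′≡t , fj′≡g′ with suc-injective (trans 1+j≡t (sym 1+j′≡t))
    ...   | refl = trans (sym fj≡g) fj′≡g′

  count-links≤2 : (Q : Path t) (u : Fin n) → count (λ g → links? Q g u) ≤ 2
  count-links≤2 {t} Q u = begin
    count (λ g → links? Q g u)       ≤⟨ count-∪ left? right? (λ g → links? Q g u) split ⟩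
    count left? + count right?       ≤⟨ +-mono-≤ (count≤1 left? left-unique) (count≤1 right? right-unique) ⟩
    2                                ∎
    where
    open ≤-Reasoning
    Left Right : Pred (Fin (m H)) 0ℓ
    Left g = ∃ λ j → j < t × f Q j ≡ g × φ Q j ≡ u
    Right g = ∃ λ j → j < t × f Q j ≡ g × φ Q (suc j) ≡ u
    left? : Decidable Left
    left? g = anyUpTo? (λ j → f Q j ≟ g ×-dec φ Q j ≟ u) t
    right? : Decidable Right
    right? g = anyUpTo? (λ j → f Q j ≟ g ×-dec φ Q (suc j) ≟ u) t
    split : (λ g → Links Q g u) ⊆ Left ∪ Right
    split (j , j<t , fj≡g , inj₁ eq) = inj₁ (j , j<t , fj≡g , eq)
    split (j , j<t , fj≡g , inj₂ eq) = inj₂ (j , j<t , fj≡g , eq)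
    left-unique : ∀ {g g′} → Left g → Left g′ → g ≡ g′
    left-unique (j , j<t , fj≡g , eq) (j′ , j′<t , fj′≡g′ , eq′)
      with φ-injective Q (m<n⇒m<1+n j<t) (m<n⇒m<1+n j′<t) (trans eq (sym eq′))
    ... | refl = trans (sym fj≡g) fj′≡g′
    right-unique : ∀ {g g′} → Right g → Right g′ → g ≡ g′
    right-unique (j , j<t , fj≡g , eq) (j′ , j′<t , fj′≡g′ , eq′)
      with suc-injective (φ-injective Q (s≤s j<t) (s≤s j′<t) (trans eq (sym eq′)))
    ... | refl = trans (sym fj≡g) fj′≡g′

  -- With t = suc s, the rotated path is φ 0, …, φ i, φ t, φ (t ∸ 1), …, φ (suc i),
  -- and f i now joins φ i to φ t.
  module Rotation {s : ℕ} (Q : Path (suc s)) {i : ℕ} (i<s : i < s) (end∈fi : end Q ∈ edge H (f Q i)) where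

    φ′ : ℕ → Fin n
    φ′ = φ Q ∘ reflect i (suc s)

    f′ : ℕ → Fin (m H)
    f′ = f Q ∘ reflect i s

    i<1+s : i < suc s
    i<1+s = m<n⇒m<1+n i<s

    reflect-i : reflect i s i ≡ i
    reflect-i = reflect-≤ {s = s} ≤-refl

    φ′-i : φ′ i ≡ φ Q i
    φ′-i = cong (φ Q) (reflect-≤ {s = suc s} ≤-refl)

    φ′-suc-i : φ′ (suc i) ≡ end Q
    φ′-suc-i = cong (φ Q) (reflect-suc-i {i} {s})

    f′-i : f′ i ≡ f Q i
    f′-i = cong (f Q) reflect-i

    ends-step : ∀ {j u} → j < suc s → j ≢ i →
      let j′ = reflect i s j in
      ((φ′ j ≡ u ⊎ φ′ (suc j) ≡ u) → Ends Q j′ u) × (Ends Q j′ u → (φ′ j ≡ u ⊎ φ′ (suc j) ≡ u))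
    ends-step j<1+s j≢i with reflect-step (s≤s⁻¹ j<1+s) j≢i
    ... | inj₁ (eq , eq′) = Sum.map (trans (cong (φ Q) (sym eq))) (trans (cong (φ Q) (sym eq′))) ,
                            Sum.map (trans (cong (φ Q) eq)) (trans (cong (φ Q) eq′))
    ... | inj₂ (eq , eq′) = swap ∘ Sum.map (trans (cong (φ Q) (sym eq))) (trans (cong (φ Q) (sym eq′))) ,
                            Sum.map (trans (cong (φ Q) eq)) (trans (cong (φ Q) eq′)) ∘ swap

    rotate : Path (suc s)
    rotate = record
      { φ = φ′
      ; f = f′
      ; φ-injective = ∘-involution-injective reflect-involution (φ-injective Q)
      ; f-injective = ∘-involution-injective reflect-involution (f-injective Q)
      ; φ∈f = left∈
      ; φsuc∈f = right∈
      ; alive = alive Q ∘ proj₁ ∘ reflect-involution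
      }
      where
      left∈ : ∀ {j} → j < suc s → φ′ j ∈ edge H (f′ j)
      left∈ {j} j<1+s with j ≟ℕ i
      ... | yes refl = subst₂ (λ v e → v ∈ edge H e) (sym φ′-i) (sym f′-i) (φ∈f Q i<1+s)
      ... | no j≢i   = ends⊆edge Q (proj₁ (reflect-involution j<1+s)) (proj₁ (ends-step j<1+s j≢i) (inj₁ refl))
      right∈ : ∀ {j} → j < suc s → φ′ (suc j) ∈ edge H (f′ j)
      right∈ {j} j<1+s with j ≟ℕ i
      ... | yes refl = subst₂ (λ v e → v ∈ edge H e) (sym φ′-suc-i) (sym f′-i) end∈fi
      ... | no j≢i   = ends⊆edge Q (proj₁ (reflect-involution j<1+s)) (proj₁ (ends-step j<1+s j≢i) (inj₂ refl))

    rotate-end : end rotate ≡ φ Q (suc i)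
    rotate-end = cong (φ Q) (trans (reflect-> {i} {suc s} (s≤s (<⇒≤ i<s))) (m+n∸n≡m (suc i) (suc s)))

    rotate-onPath⁺ : ∀ {u} → OnPath Q u → OnPath rotate u
    rotate-onPath⁺ = ∘-involution-image⁺ reflect-involution

    rotate-onPath⁻ : ∀ {u} → OnPath rotate u → OnPath Q u
    rotate-onPath⁻ = ∘-involution-image⁻ reflect-involution

    rotate-edgeOf⁺ : ∀ {g} → EdgeOf Q g → EdgeOf rotate g
    rotate-edgeOf⁺ = ∘-involution-image⁺ reflect-involution

    rotate-edgeOf⁻ : ∀ {g} → EdgeOf rotate g → EdgeOf Q g
    rotate-edgeOf⁻ = ∘-involution-image⁻ reflect-involution

    rotate-links⁻ : ∀ {g u} → g ≢ f Q i → Links rotate g u → Links Q g u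
    rotate-links⁻ g≢fi (j , j<1+s , f′j≡g , ends) with j ≟ℕ i
    ... | yes refl = contradiction (trans (sym f′j≡g) f′-i) g≢fi
    ... | no j≢i   = reflect i s j , proj₁ (reflect-involution j<1+s) , f′j≡g , proj₁ (ends-step j<1+s j≢i) ends

    rotate-links⁺ : ∀ {g u} → g ≢ f Q i → Links Q g u → Links rotate g u
    rotate-links⁺ g≢fi (j′ , j′<1+s , fj′≡g , ends) with reflect-involution j′<1+s
    ... | j<1+s , rj≡j′ with reflect i s j′ ≟ℕ i
    ...   | yes j≡i = contradiction (trans (sym fj′≡g) (cong (f Q) (trans (sym rj≡j′) (trans (cong (reflect i s) j≡i) reflect-i)))) g≢fi
    ...   | no j≢i  = reflect i s j′ , j<1+s , trans (cong (f Q) rj≡j′) fj′≡g ,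
                      proj₂ (ends-step j<1+s j≢i) (subst (λ p → Ends Q p _) (sym rj≡j′) ends)

    rotate-links-fi : ∀ {u} → Links rotate (f Q i) u → φ Q i ≡ u ⊎ end Q ≡ u
    rotate-links-fi (j , j<1+s , f′j≡fi , ends)
      with ∘-involution-injective reflect-involution (f-injective Q) j<1+s i<1+s (trans f′j≡fi (sym f′-i))
    ... | refl = Sum.map (trans (sym φ′-i)) (trans (sym φ′-suc-i)) ends

-- Hyperedges of size at most four

module SmallEdges {n : ℕ} (H : Hypergraph n) (size≤4 : ∀ g → ∣ edge H g ∣ ≤ 4) (W : Subset n) where

  open OnVertexSet H W
  open import Data.List.Membership.DecPropositional (_≟_ {n}) using () renaming (_∈?_ to _∈ₗ?_)

  Escaping : Path t → Pred (Fin (m H)) 0ℓ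
  Escaping Q g = ∃ λ o → o ∈ W × ¬ OnPath Q o × o ∈ edge H g

  escaping? : (Q : Path t) → Decidable (Escaping Q)
  escaping? Q g = any? (λ o → o ∈? W ×-dec ¬? (onPath? Q o) ×-dec o ∈? edge H g)

  Spare : Path t → Fin (m H) → Pred (Fin n) 0ℓ
  Spare Q g z = EdgeOf Q g × z ∈ edge H g × OnPath Q z × ¬ Links Q g z

  spare? : (Q : Path t) (g : Fin (m H)) → Decidable (Spare Q g)
  spare? Q g z = edgeOf? Q g ×-dec z ∈? edge H g ×-dec onPath? Q z ×-dec ¬? (links? Q g z)

  count-edge≤4 : {P : Pred (Fin n) 0ℓ} (P? : Decidable P) (g : Fin (m H)) → P ⊆ (_∈ edge H g) → count P? ≤ 4
  count-edge≤4 P? g P⊆g = begin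
    count P?                 ≤⟨ count-mono P? (_∈? edge H g) P⊆g ⟩
    count (_∈? edge H g)     ≡⟨ count-∈≡∣p∣ (edge H g) ⟩
    ∣ edge H g ∣             ≤⟨ size≤4 g ⟩
    4                        ∎
    where open ≤-Reasoning

  spare-unique : (Q : Path t) {g : Fin (m H)} {z z′ : Fin n} → Escaping Q g → Spare Q g z → Spare Q g z′ → z ≡ z′
  spare-unique Q {g} {z} {z′} (o , _ , o∉Q , o∈g) ((j , j<t , fj≡g) , z∈g , z∈Q , z-unlinked) (_ , z′∈g , z′∈Q , z′-unlinked)
    with z ≟ z′
  ... | yes z≡z′ = z≡z′
  ... | no z≢z′  = contradiction (≤-trans (unique-length≤count (_∈? edge H g) distinct (o∈g ∷ a∈g ∷ b∈g ∷ z∈g ∷ z′∈g ∷ []))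
                                         (count-edge≤4 (_∈? edge H g) g id))
                                 1+n≰n
    where
    open Σ (ends∈edge Q j<t fj≡g) renaming (proj₁ to a∈g; proj₂ to b∈g)
    o≢ : ∀ {x} → OnPath Q x → o ≢ x
    o≢ x∈Q refl = o∉Q x∈Q
    ends≢z : φ Q j ≢ z × φ Q (suc j) ≢ z
    ends≢z = unlinked⇒≢ends Q j<t fj≡g z-unlinked
    ends≢z′ : φ Q j ≢ z′ × φ Q (suc j) ≢ z′
    ends≢z′ = unlinked⇒≢ends Q j<t fj≡g z′-unlinked
    distinct : Unique (o ∷ φ Q j ∷ φ Q (suc j) ∷ z ∷ z′ ∷ [])
    distinct = (o≢ (φ-onPath Q (m<n⇒m<1+n j<t)) ∷ o≢ (φ-onPath Q (s≤s j<t)) ∷ o≢ z∈Q ∷ o≢ z′∈Q ∷ [])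
             ∷ (ends-distinct Q j<t ∷ proj₁ ends≢z ∷ proj₁ ends≢z′ ∷ [])
             ∷ (proj₂ ends≢z ∷ proj₂ ends≢z′ ∷ [])
             ∷ (z≢z′ ∷ [])
             ∷ [] ∷ []

  EndSpare : Path t → Pred (Fin (m H)) 0ℓ
  EndSpare Q g = Escaping Q g × Spare Q g (end Q)

  endSpare? : (Q : Path t) → Decidable (EndSpare Q)
  endSpare? Q g = escaping? Q g ×-dec spare? Q g (end Q)

  EndExit : Path t → Fin (m H) → Pred (Fin n) 0ℓ
  EndExit Q g u = EdgeOf Q g × end Q ∈ edge H g × u ∈ edge H g × ¬ OnPath Q u × u ∈ W

  endExit? : (Q : Path t) (g : Fin (m H)) → Decidable (EndExit Q g)
  endExit? Q g u = edgeOf? Q g ×-dec end Q ∈? edge H g ×-dec u ∈? edge H g ×-dec ¬? (onPath? Q u) ×-dec u ∈? W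

  length+count-endExit≤4 : (Q : Path t) {g : Fin (m H)} {xs : List (Fin n)} → Unique xs →
                           All (λ x → x ∈ edge H g × OnPath Q x) xs → length xs + count (endExit? Q g) ≤ 4
  length+count-endExit≤4 Q {g} unique xs∈g∩Q = ≤-trans
    (unique-length+count≤count (_∈? edge H g) (endExit? Q g) unique (All.map proj₁ xs∈g∩Q)
      (λ (_ , _ , u∈g , u∉Q , _) → u∈g , All.map (λ (_ , x∈Q) u≡x → u∉Q (subst (OnPath Q) (sym u≡x) x∈Q)) xs∈g∩Q))
    (count-edge≤4 (_∈? edge H g) g id)

  count-endExit≤ : (Q : Path t) (g : Fin (m H)) (L? : Dec (Links Q g (end Q))) (S? : Dec (EndSpare Q g)) →
                   count (endExit? Q g) ≤ 2 * indicator L? + indicator S?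
  count-endExit≤ Q g (yes (j , j<t , fj≡g , _)) _ =
    ≤-trans (+-cancelˡ-≤ 2 _ 2 (length+count-endExit≤4 Q ((ends-distinct Q j<t ∷ []) ∷ [] ∷ [])
                                  ((a∈g , φ-onPath Q (m<n⇒m<1+n j<t)) ∷ (b∈g , φ-onPath Q (s≤s j<t)) ∷ [])))
            (m≤m+n 2 _)
    where
    open Σ (ends∈edge Q j<t fj≡g) renaming (proj₁ to a∈g; proj₂ to b∈g)
  count-endExit≤ Q g (no _) (yes (_ , (j , j<t , fj≡g) , end∈g , _ , end-unlinked)) =
    +-cancelˡ-≤ 3 _ 1 (length+count-endExit≤4 Q
      ((ends-distinct Q j<t ∷ proj₁ (unlinked⇒≢ends Q j<t fj≡g end-unlinked) ∷ []) ∷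
       (proj₂ (unlinked⇒≢ends Q j<t fj≡g end-unlinked) ∷ []) ∷ [] ∷ [])
      ((a∈g , φ-onPath Q (m<n⇒m<1+n j<t)) ∷ (b∈g , φ-onPath Q (s≤s j<t)) ∷ (end∈g , end-onPath Q) ∷ []))
    where
    open Σ (ends∈edge Q j<t fj≡g) renaming (proj₁ to a∈g; proj₂ to b∈g)
  count-endExit≤ Q g (no end-unlinked) (no ¬spare) =
    ≤-reflexive (count-∅ (endExit? Q g) (λ u (g∈Q , end∈g , u∈g , u∉Q , u∈W) →
      ¬spare ((u , u∈W , u∉Q , u∈g) , g∈Q , end∈g , end-onPath Q , end-unlinked)))

  count-exits≤ : (Q : Path t) → count (λ u → any? (λ g → endExit? Q g u)) ≤ 2 + count (endSpare? Q)
  count-exits≤ Q = begin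
    count (λ u → any? (λ g → endExit? Q g u))                         ≤⟨ count-∃≤∑ (endExit? Q) (λ u → any? (λ g → endExit? Q g u)) ⟩
    sum (λ g → count (endExit? Q g))                                  ≤⟨ sum-mono-≤ (λ g → count-endExit≤ Q g (L? g) (endSpare? Q g)) ⟩
    sum (λ g → 2 * indicator (L? g) + indicator (endSpare? Q g))      ≡⟨ ∑-distrib-+ (λ g → 2 * indicator (L? g)) (indicator ∘ endSpare? Q) ⟩
    sum (λ g → 2 * indicator (L? g)) + count (endSpare? Q)            ≡⟨ cong (_+ count (endSpare? Q)) (*-distribˡ-sum 2 (indicator ∘ L?)) ⟨
    2 * count L? + count (endSpare? Q)                                ≤⟨ +-monoˡ-≤ _ (*-monoʳ-≤ 2 (count-links-end≤1 Q)) ⟩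
    2 + count (endSpare? Q)                                           ∎
    where
    open ≤-Reasoning
    L? : Decidable (λ g → Links Q g (end Q))
    L? g = links? Q g (end Q)

  end-degree≤ : ¬ Path (suc t) → (Q : Path t) → degree (end Q) ≤ t + (2 + count (endSpare? Q))
  end-degree≤ {t} maximal Q = begin
    degree (end Q)                                                    ≤⟨ count-∪ (imageBelow? _≟_ t (φ Q)) exit? (neighbour? (end Q)) split ⟩
    count (imageBelow? _≟_ t (φ Q)) + count exit?                     ≤⟨ +-mono-≤ (count-imageBelow≤ t (φ Q)) (count-exits≤ Q) ⟩
    t + (2 + count (endSpare? Q))                                     ∎
    where
    open ≤-Reasoning
    exit? : Decidable (λ u → ∃ λ g → EndExit Q g u)
    exit? u = any? (λ g → endExit? Q g u)
    split : Neighbour (end Q) ⊆ ImageBelow t (φ Q) ∪ (λ u → ∃ λ g → EndExit Q g u)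
    split {u} (u∈W , u≢end , g , end∈g , u∈g) with onPath? Q u | edgeOf? Q g
    ... | yes (p , p<1+t , φp≡u) | _ = inj₁ (p , ≤∧≢⇒< (s≤s⁻¹ p<1+t) (λ { refl → u≢end (sym φp≡u) }) , φp≡u)
    ... | no u∉Q | yes g∈Q = inj₂ (g , g∈Q , end∈g , u∈g , u∉Q , u∈W)
    ... | no u∉Q | no g∉Q  = contradiction (extend Q g∉Q end∈g u∈g u∈W u∉Q) maximal

  module Rotations {s : ℕ} (P : Path (suc s)) (mindeg : ∀ {u} → u ∈ W → suc s + 10 ≤ degree u)
                   (maximal : ¬ Path (suc (suc s))) where

    8≤count-endSpare : (Q : Path (suc s)) → 8 ≤ count (endSpare? Q)
    8≤count-endSpare Q = +-cancelˡ-≤ 2 8 _ (+-cancelˡ-≤ (suc s) 10 _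
                           (≤-trans (mindeg (alive Q (n<1+n _))) (end-degree≤ maximal Q)))

    Owns : Fin n → Pred (Fin (m H)) 0ℓ
    Owns x g = Escaping P g × Spare P g x

    owns? : (x : Fin n) → Decidable (Owns x)
    owns? x g = escaping? P g ×-dec spare? P g x

    owner-unique : ∀ {x y g} → Owns x g → Owns y g → x ≡ y
    owner-unique (escaping , spare) (_ , spare′) = spare-unique P escaping spare spare′

    SameLinks : Path (suc s) → Fin (m H) → Set
    SameLinks Q g = ∀ {u} → (Links Q g u → Links P g u) × (Links P g u → Links Q g u)

    -- A path with the vertices and edges of P, ending at x, obtained by rotations whose
    -- new ends are listed in xs. Its links differ from those of P only at edges rotated
    -- along, and such an edge has its P-spare vertex in xs but not equal to x, and its
    -- spare vertex in xs.
    record Rotated (xs : List (Fin n)) (x : Fin n) : Set where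
      field
        path : Path (suc s)
        end≡x : end path ≡ x
        onQ⇒onP : ∀ {u} → OnPath path u → OnPath P u
        onP⇒onQ : ∀ {u} → OnPath P u → OnPath path u
        edgeQ⇒edgeP : ∀ {g} → EdgeOf path g → EdgeOf P g
        edgeP⇒edgeQ : ∀ {g} → EdgeOf P g → EdgeOf path g
        P-spare⇒same : ∀ {g z} → Escaping P g → Spare P g z → z ≡ x ⊎ z ∉ₗ xs → SameLinks path g
        Q-spare⇒same : ∀ {g z} → Escaping P g → Spare path g z → z ∉ₗ xs → SameLinks path g
        7≤owned : 7 ≤ count (owns? x)
        x∈xs : x ∈ₗ xs

    open Rotated

    weaken : ∀ {xs x} y → Rotated xs x → Rotated (y ∷ xs) x
    weaken y R = record
      { path = path R
      ; end≡x = end≡x R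
      ; onQ⇒onP = onQ⇒onP R
      ; onP⇒onQ = onP⇒onQ R
      ; edgeQ⇒edgeP = edgeQ⇒edgeP R
      ; edgeP⇒edgeQ = edgeP⇒edgeQ R
      ; P-spare⇒same = λ escaping spare → P-spare⇒same R escaping spare ∘ Sum.map₂ (_∘ there)
      ; Q-spare⇒same = λ escaping spare z∉ → Q-spare⇒same R escaping spare (z∉ ∘ there)
      ; 7≤owned = 7≤owned R
      ; x∈xs = there (x∈xs R)
      }

    Fresh : ∀ {xs x} → Rotated xs x → Set
    Fresh {xs} {x} R = ∃ λ i → i < suc s × Owns x (f (path R) i) × φ (path R) (suc i) ∉ₗ xs

    Closed : ∀ {xs x} → Rotated xs x → Set
    Closed {xs} {x} R = ∀ {i} → i < suc s → Owns x (f (path R) i) → φ (path R) (suc i) ∈ₗ xs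

    fresh-or-closed : ∀ {xs x} (R : Rotated xs x) → Fresh R ⊎ Closed R
    fresh-or-closed {xs} {x} R with anyUpTo? (λ i → owns? x (f (path R) i) ×-dec ¬? (φ (path R) (suc i) ∈ₗ? xs)) (suc s)
    ... | yes fresh = inj₁ fresh
    ... | no ¬fresh = inj₂ closed
      where
      closed : Closed R
      closed {i} i<t owns with φ (path R) (suc i) ∈ₗ? xs
      ... | yes y∈xs = y∈xs
      ... | no y∉xs  = contradiction (i , i<t , owns , y∉xs) ¬fresh

    module Rotate {xs : List (Fin n)} {x : Fin n} (R : Rotated xs x) {i : ℕ} (i<t : i < suc s)
                (owns : Owns x (f (path R) i)) (y∉xs : φ (path R) (suc i) ∉ₗ xs) where

      private
        Q′ : Path (suc s)
        Q′ = path R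
        g : Fin (m H)
        g = f Q′ i
        y : Fin n
        y = φ Q′ (suc i)
        x∈g : x ∈ edge H g
        x∈g = proj₁ (proj₂ (proj₂ owns))
        x-unlinked : ¬ Links Q′ g x
        x-unlinked = proj₂ (proj₂ (proj₂ (proj₂ owns))) ∘ proj₁ (P-spare⇒same R (proj₁ owns) (proj₂ owns) (inj₁ refl))

      i<s : i < s
      i<s = s≤s⁻¹ (≤∧≢⇒< i<t (λ 1+i≡1+s → x-unlinked (i , i<t , refl , inj₂ (trans (cong (φ Q′) 1+i≡1+s) (end≡x R)))))

      open Rotation Q′ i<s (subst (_∈ edge H g) (sym (end≡x R)) x∈g)

      escaping⇒rotate : ∀ {g′} → Escaping P g′ → Escaping rotate g′
      escaping⇒rotate (o , o∈W , o∉P , o∈g′) = o , o∈W , o∉P ∘ onQ⇒onP R ∘ rotate-onPath⁻ , o∈g′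

      rotate⇒escaping : ∀ {g′} → Escaping rotate g′ → Escaping P g′
      rotate⇒escaping (o , o∈W , o∉rot , o∈g′) = o , o∈W , o∉rot ∘ rotate-onPath⁺ ∘ onP⇒onQ R , o∈g′

      same-away-from-g : ∀ {g′} → g′ ≢ g → SameLinks Q′ g′ → SameLinks rotate g′
      same-away-from-g g′≢g same = proj₁ same ∘ rotate-links⁻ g′≢g , rotate-links⁺ g′≢g ∘ proj₂ same

      rotate⇒spare : ∀ {g′ z} → g′ ≢ g → Spare rotate g′ z → Spare Q′ g′ z
      rotate⇒spare g′≢g (g′∈rot , z∈g′ , z∈rot , z-unlinked) =
        rotate-edgeOf⁻ g′∈rot , z∈g′ , rotate-onPath⁻ z∈rot , z-unlinked ∘ rotate-links⁺ g′≢g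

      y-spare : Spare rotate g y
      y-spare = rotate-edgeOf⁺ (i , i<t , refl) , φsuc∈f Q′ i<t , rotate-onPath⁺ (suc i , s≤s i<t , refl) , y-unlinked
        where
        y-unlinked : ¬ Links rotate g y
        y-unlinked linked with rotate-links-fi linked
        ... | inj₁ φi≡y   = 1+n≢n (sym (φ-injective Q′ (m<n⇒m<1+n i<t) (s≤s i<t) φi≡y))
        ... | inj₂ end≡y = <⇒≢ (s≤s i<s) (sym (φ-injective Q′ (n<1+n _) (s≤s i<t) end≡y))

      off-xs : ∀ {z} → z ≡ y ⊎ z ∉ₗ y ∷ xs → z ∉ₗ xs
      off-xs = Sum.[ (λ { refl → y∉xs }) , _∘ there ]

      P-spare⇒same′ : ∀ {g′ z} → Escaping P g′ → Spare P g′ z → z ≡ y ⊎ z ∉ₗ y ∷ xs → SameLinks rotate g′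
      P-spare⇒same′ {g′} escaping spare z-new with g′ ≟ g
      ... | yes refl = contradiction (subst (_∈ₗ xs) (owner-unique owns (escaping , spare)) (x∈xs R)) (off-xs z-new)
      ... | no g′≢g  = same-away-from-g g′≢g (P-spare⇒same R escaping spare (inj₂ (off-xs z-new)))

      Q-spare⇒same′ : ∀ {g′ z} → Escaping P g′ → Spare rotate g′ z → z ∉ₗ y ∷ xs → SameLinks rotate g′
      Q-spare⇒same′ {g′} escaping spare z∉ with g′ ≟ g
      ... | yes refl = contradiction (here (spare-unique rotate (escaping⇒rotate escaping) spare y-spare)) z∉
      ... | no g′≢g  = same-away-from-g g′≢g (Q-spare⇒same R escaping (rotate⇒spare g′≢g spare) (z∉ ∘ there))

      endSpare⇒owns : ∀ {g′} → EndSpare rotate g′ → g′ ≡ g ⊎ Owns y g′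
      endSpare⇒owns {g′} (escaping , spare) with g′ ≟ g
      ... | yes g′≡g = inj₁ g′≡g
      ... | no g′≢g  = inj₂ (rotate⇒escaping escaping , spare⇒P-spare (subst (Spare Q′ g′) rotate-end (rotate⇒spare g′≢g spare)))
        where
        spare⇒P-spare : Spare Q′ g′ y → Spare P g′ y
        spare⇒P-spare y-spare′@(g′∈Q , y∈g′ , y∈Q , y-unlinked) =
          edgeQ⇒edgeP R g′∈Q , y∈g′ , onQ⇒onP R y∈Q ,
          y-unlinked ∘ proj₂ (Q-spare⇒same R (rotate⇒escaping escaping) y-spare′ y∉xs)

      7≤owned′ : 7 ≤ count (owns? y)
      7≤owned′ = s≤s⁻¹ (begin
        8                                   ≤⟨ 8≤count-endSpare rotate ⟩
        count (endSpare? rotate)            ≤⟨ count-∪ (_≟ g) (owns? y) (endSpare? rotate) endSpare⇒owns ⟩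
        count (_≟ g) + count (owns? y)      ≤⟨ +-monoˡ-≤ _ (count≤1 (_≟ g) (λ { refl refl → refl })) ⟩
        suc (count (owns? y))               ∎)
        where open ≤-Reasoning

      rotated : Rotated (y ∷ xs) y
      rotated = record
        { path = rotate
        ; end≡x = rotate-end
        ; onQ⇒onP = onQ⇒onP R ∘ rotate-onPath⁻
        ; onP⇒onQ = rotate-onPath⁺ ∘ onP⇒onQ R
        ; edgeQ⇒edgeP = edgeQ⇒edgeP R ∘ rotate-edgeOf⁻
        ; edgeP⇒edgeQ = rotate-edgeOf⁺ ∘ edgeP⇒edgeQ R
        ; P-spare⇒same = P-spare⇒same′
        ; Q-spare⇒same = Q-spare⇒same′
        ; 7≤owned = 7≤owned′
        ; x∈xs = here refl
        }

    closed⇒linked : ∀ {xs x g} (R : Rotated xs x) → Closed R → Owns x g → Any (λ u → Links P g u) xs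
    closed⇒linked R closed owns@(escaping , spare@(g∈P , _)) with edgeP⇒edgeQ R g∈P
    ... | i , i<t , refl = Any.map (λ { refl → proj₁ (P-spare⇒same R escaping spare (inj₁ refl)) (i , i<t , refl , inj₂ refl) })
                                   (closed i<t owns)

    closure-contradiction : ∀ {xs x₀} → Unique xs → x₀ ∈ₗ xs → All (λ x → Σ (Rotated xs x) Closed) xs → ⊥
    closure-contradiction {xs@(_ ∷ _)} unique _ closed = <⇒≱ (*-monoʳ-< (length xs) (s≤s (s≤s (s≤s z≤n)))) (begin
      length xs * 7                 ≤⟨ count-any≥ owns? owner-unique unique (All.map (7≤owned ∘ proj₁) closed) ⟩
      count (any-in? owns? xs)      ≤⟨ count-mono (any-in? owns? xs) (any-in? (λ u g → links? P g u) xs) owned⇒linked ⟩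
      count (any-in? (λ u g → links? P g u) xs) ≤⟨ count-any≤ (λ u g → links? P g u) (count-links≤2 P) xs ⟩
      length xs * 2                 ∎)
      where
      open ≤-Reasoning
      owned⇒linked : ∀ {g} → Any (λ x → Owns x g) xs → Any (λ u → Links P g u) xs
      owned⇒linked owned with find owned
      ... | x , x∈xs , owns with All.lookup closed x∈xs
      ...   | R , R-closed = closed⇒linked R R-closed owns

    fresh-or-all-closed : ∀ {xs ys} → All (Rotated xs) ys →
                          (∃ λ x → Σ (Rotated xs x) Fresh) ⊎ All (λ x → Σ (Rotated xs x) Closed) ys
    fresh-or-all-closed []       = inj₂ []
    fresh-or-all-closed (R ∷ Rs) with fresh-or-closed R | fresh-or-all-closed Rs
    ... | inj₁ fresh  | _           = inj₁ (_ , R , fresh)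
    ... | inj₂ _      | inj₁ found  = inj₁ found
    ... | inj₂ closed | inj₂ closeds = inj₂ ((R , closed) ∷ closeds)

    explore : ∀ {xs x₀} → Unique xs → x₀ ∈ₗ xs → All (Rotated xs) xs → Acc _<_ (count (∁? (_∈ₗ? xs))) → ⊥
    explore {xs} unique x₀∈xs Rs (acc smaller) with fresh-or-all-closed Rs
    ... | inj₂ closeds = closure-contradiction unique x₀∈xs closeds
    ... | inj₁ (x , R , i , i<t , owns , y∉xs) =
      explore (¬Any⇒All¬ xs y∉xs ∷ unique) (there x₀∈xs) (rotated ∷ All.map (weaken _) Rs)
              (smaller (count-remove (∁? (_∈ₗ? xs)) (∁? (_∈ₗ? (_ ∷ xs))) (_∘ there) y∉xs (λ z∉ → z∉ ∘ here)))
      where open Rotate R i<t owns y∉xs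

    initial : Rotated (end P ∷ []) (end P)
    initial = record
      { path = P
      ; end≡x = refl
      ; onQ⇒onP = id
      ; onP⇒onQ = id
      ; edgeQ⇒edgeP = id
      ; edgeP⇒edgeQ = id
      ; P-spare⇒same = λ _ _ _ → id , id
      ; Q-spare⇒same = λ _ _ _ → id , id
      ; 7≤owned = ≤-trans (n≤1+n 7) (≤-trans (8≤count-endSpare P) (count-mono (endSpare? P) (owns? (end P)) id))
      ; x∈xs = here refl
      }

    maximal-path-impossible : ⊥
    maximal-path-impossible = explore ([] ∷ []) (here refl) (initial ∷ []) (<-wellFounded _)

  -- Maximality is refuted rather than the extension constructed, hence the double negation.
  no-maximal-path : (∀ {u} → u ∈ W → t + 10 ≤ degree u) → Path t → ¬ ¬ Path (suc t)
  no-maximal-path {zero}  mindeg P maximal = <⇒≱ (s≤s (s≤s (s≤s z≤n))) (begin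
    10                                 ≤⟨ mindeg (alive P (s≤s z≤n)) ⟩
    degree (end P)                     ≤⟨ end-degree≤ maximal P ⟩
    2 + count (endSpare? P)            ≡⟨ cong (2 +_) (count-∅ (endSpare? P) (λ { _ (_ , (_ , () , _) , _) })) ⟩
    2                                  ∎)
    where open ≤-Reasoning
  no-maximal-path {suc s} mindeg P maximal = Rotations.maximal-path-impossible P mindeg maximal

  paths-up-to : (k : ℕ) → (∀ {u} → u ∈ W → k + 9 ≤ degree u) → Path 0 → ∀ t → t ≤ k → ¬ ¬ Path t
  paths-up-to k mindeg P₀ zero    _   ¬P₀   = ¬P₀ P₀
  paths-up-to k mindeg P₀ (suc t) t<k ¬Pt+1 =
    paths-up-to k mindeg P₀ t (<⇒≤ t<k) (λ Pt → no-maximal-path mindeg′ Pt ¬Pt+1)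
    where
    mindeg′ : ∀ {u} → u ∈ W → t + 10 ≤ degree u
    mindeg′ u∈W = ≤-trans (≤-reflexive (+-suc t 9)) (≤-trans (+-monoˡ-≤ 9 t<k) (mindeg u∈W))

  low-degree-vertex : (k : ℕ) → ¬ BergePath k H → ∀ {v} → v ∈ W → ∃ λ u → u ∈ W × degree u ≤ k + 8
  low-degree-vertex k no-path {v} v∈W with any? (λ u → u ∈? W ×-dec degree u ≤? k + 8)
  ... | yes found = found
  ... | no none   = ⊥-elim (paths-up-to k mindeg (singleton g₀ v∈W) k ≤-refl (no-path ∘ toBergePath))
    where
    mindeg : ∀ {u} → u ∈ W → k + 9 ≤ degree u
    mindeg {u} u∈W = subst (_≤ degree u) (sym (+-suc k 8)) (≰⇒> (λ low → none (u , u∈W , low)))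
    g₀ : Fin (m H)
    g₀ with 0<count⇒satisfiable (neighbour? v) (≤-trans (s≤s z≤n) (≤-trans (m≤n+m 9 k) (mindeg v∈W)))
    ... | _ , _ , _ , g , _ = g

-- Greedy colouring

module GreedyColouring {n : ℕ} (H : Hypergraph n) (d : ℕ)
                       (low-degree : ∀ {W : Subset n} {v} → v ∈ W → ∃ λ u → u ∈ W × OnVertexSet.degree H W u ≤ d) where

  RainbowOn : Subset n → (Fin n → Fin (suc d)) → Set
  RainbowOn W col = ∀ i {u v} → u ∈ W → v ∈ W → u ∈ edge H i → v ∈ edge H i → u ≢ v → col u ≢ col v

  colour : (W : Subset n) → Acc _<_ ∣ W ∣ → Σ (Fin n → Fin (suc d)) (RainbowOn W)
  colour W (acc smaller) with nonempty? W
  ... | no empty       = (λ _ → zero) , λ _ u∈W → contradiction (_ , u∈W) empty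
  ... | yes (_ , v∈W) with low-degree v∈W
  ...   | u , u∈W , low with colour (W - u) (smaller (x∈p⇒∣p-x∣<∣p∣ u∈W))
  ...     | col′ , rainbow′ = col , rainbow
    where
    open OnVertexSet H W using (Neighbour; neighbour?; degree)
    used? : Decidable (λ γ → ∃ λ z → Neighbour u z × col′ z ≡ γ)
    used? γ = any? (λ z → neighbour? u z ×-dec col′ z ≟ γ)
    free : ∃ λ γ → ¬ ∃ λ z → Neighbour u z × col′ z ≡ γ
    free = count<n⇒∃∁ used? (s≤s (≤-trans (count-image≤ (neighbour? u) col′) low))
    col : Fin n → Fin (suc d)
    col = updateAt col′ u (λ _ → proj₁ free)
    col-u : col u ≡ proj₁ free
    col-u = updateAt-updates u col′
    col-z : ∀ {z} → z ≢ u → col z ≡ col′ z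
    col-z z≢u = updateAt-minimal _ u col′ z≢u
    stay : ∀ {z} → z ∈ W → z ≢ u → z ∈ W - u
    stay z∈W z≢u = x∈p∧x∉q⇒x∈p─q z∈W (x≢y⇒x∉⁅y⁆ z≢u)
    avoid : ∀ {i z} → z ∈ W → z ≢ u → u ∈ edge H i → z ∈ edge H i → col u ≢ col z
    avoid {i} z∈W z≢u u∈i z∈i eq = proj₂ free (_ , (z∈W , z≢u , i , u∈i , z∈i) , trans (sym (col-z z≢u)) (trans (sym eq) col-u))
    rainbow : RainbowOn W col
    rainbow i {a} {b} a∈W b∈W a∈i b∈i a≢b with a ≟ u | b ≟ u
    ... | yes refl | yes refl = contradiction refl a≢b
    ... | yes refl | no b≢u   = avoid b∈W b≢u a∈i b∈i
    ... | no a≢u   | yes refl = avoid a∈W a≢u b∈i a∈i ∘ sym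
    ... | no a≢u   | no b≢u   = λ eq → rainbow′ i (stay a∈W a≢u) (stay b∈W b≢u) a∈i b∈i a≢b
                                           (trans (sym (col-z a≢u)) (trans eq (col-z b≢u)))

  strongly-colourable : StrongChromaticAtMost H (suc d)
  strongly-colourable with colour ⊤ (<-wellFounded _)
  ... | col , rainbow = col , λ i u v u∈i v∈i u≢v → rainbow i ∈⊤ ∈⊤ u∈i v∈i u≢v

proposition5p8 : (k : ℕ) → 1 ≤ k → (n : ℕ) → (H : Hypergraph n) →
    IsSimple H → SizesBetween2and4 H → ¬ BergePath k H →
    StrongChromaticAtMost H (k + 9)
proposition5p8 k _ n H _ sizes no-path =
  subst (StrongChromaticAtMost H) (sym (+-suc k 8))
        (GreedyColouring.strongly-colourable H (k + 8) (SmallEdges.low-degree-vertex H (proj₂ ∘ sizes) _ k no-path))
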